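{- Let $G$ be a finite abstract simplicial complex with connection Laplacian $L$ and Green's function $g=L^{ -1}$. If $x\in G$ is a facet and $y\in G$ satisfies $y\subset x$, then $g(x,y)=\omega(y)=(-1)^{\dim(y)}$.
   Context: A finite abstract simplicial complex $G$ is a finite set of nonempty finite sets closed under taking nonempty subsets; $\dim(y)=|y|-1$. The connection Laplacian $L$ is the matrix indexed by $G$ with $L(x,y)=1$ if $x\cap y\neq\emptyset$ and $0$ otherwise; it is invertible and $g=L^{ -1}$. A facet is an element $x\in G$ not contained in any other element of $G$. -}

module Defs where

open import Data.Nat using (ℕ; zero; suc; _∸_)
open import Data.Fin using (Fin; zero; suc)
open import Data.Fin.Subset using (Subset; _∩_; ∣_∣; Nonempty; _⊆_)
open import Data.Fin.Subset.Properties using (nonempty?)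
open import Data.Rational using (ℚ; 0ℚ; 1ℚ; _+_; _*_; -_)
open import Data.Product using (∃; _×_)
open import Data.Bool using (if_then_else_)
open import Relation.Nullary using (does)
open import Relation.Binary.PropositionalEquality using (_≡_)

-- A finite abstract simplicial complex on vertex set Fin m with n elements,
-- given as an enumeration G : Fin n → Subset m of its (distinct) simplices.
record IsSimplicialComplex {m n : ℕ} (G : Fin n → Subset m) : Set where
  field
    distinct  : ∀ i j → G i ≡ G j → i ≡ j
    nonempty  : ∀ i → Nonempty (G i)
    downClosed : ∀ i (s : Subset m) → Nonempty s → s ⊆ G i → ∃ λ j → G j ≡ s

Σℚ : (n : ℕ) → (Fin n → ℚ) → ℚ
Σℚ zero    f = 0ℚ
Σℚ (suc n) f = f zero + Σℚ n (λ i → f (suc i))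

Matrix : ℕ → Set
Matrix n = Fin n → Fin n → ℚ

_·_ : {n : ℕ} → Matrix n → Matrix n → Matrix n
_·_ {n} A B i j = Σℚ n (λ k → A i k * B k j)

δ : {n : ℕ} → Matrix n
δ zero    zero    = 1ℚ
δ zero    (suc _) = 0ℚ
δ (suc _) zero    = 0ℚ
δ (suc i) (suc j) = δ i j

connectionLaplacian : {m n : ℕ} → (Fin n → Subset m) → Matrix n
connectionLaplacian G i j = if does (nonempty? (G i ∩ G j)) then 1ℚ else 0ℚ

IsInverse : {n : ℕ} → Matrix n → Matrix n → Set
IsInverse L g = (∀ i j → (L · g) i j ≡ δ i j) × (∀ i j → (g · L) i j ≡ δ i j)

IsFacet : {m n : ℕ} → (Fin n → Subset m) → Fin n → Set
IsFacet G x = ∀ z → G x ⊆ G z → G z ≡ G x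

signPow : ℕ → ℚ
signPow zero    = 1ℚ
signPow (suc k) = - signPow k

dim : {m : ℕ} → Subset m → ℕ
dim s = ∣ s ∣ ∸ 1

ω : {m : ℕ} → Subset m → ℚ
ω s = signPow (dim s)

module Submission where

-- Let x be a facet of G and let v be the
-- row vector  v(z) = ω(z) if z ⊆ x, and 0 otherwise.  We show that v L is the
-- x-th unit row vector; since L g = 1, associativity then gives
-- g(x,y) = (v L g)(y) = v(y), which is ω(y) for y ⊆ x.
--
-- The identity (v L)(w) = δ(x,w) is a sign-reversing involution argument.
-- Fix a vertex a of x and let σ toggle a in the simplices of x
-- (z ↦ z Δ {a}); by down-closure this is an involution of G, it reverses ω,
-- and the only face of x it cannot pair off is {a}, whose toggle is empty.
-- Whenever toggling a does not change whether a face meets w, the sum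
-- Σ_z v(z) L(z,w) therefore collapses to L({a},w).  For w = x every face of x
-- meets x, giving 1; for w ≠ x the facet property yields a vertex a ∈ x \ w,
-- and toggling a vertex outside w never changes meeting w, giving 0.

open import Defs
open import Data.Nat using (ℕ; zero; suc; _∸_; _<_; _≤_)
open import Data.Fin using (Fin; zero; suc; _≟_)
open import Data.Fin.Properties using (suc-injective; ¬∀⟶∃¬)
open import Data.Fin.Subset
  using (Subset; _⊆_; _∈_; _∉_; _∩_; ∣_∣; Nonempty; ⊥; ⁅_⁆; inside; outside)
open import Data.Fin.Subset.Properties
  using ( nonempty?; _⊆?_; _∈?_; Empty-unique; ∉⊥; x∈⁅x⁆; x∈⁅y⁆⇒x≡y; ∣⁅x⁆∣≡1
        ; p⊆q⇒∣p∣≤∣q∣; x∈p∩q⁺; x∈p∩q⁻ )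
open import Data.Vec using (_∷_; here; there)
open import Data.Bool using (not; if_then_else_)
open import Data.Rational using (ℚ; 0ℚ; 1ℚ; ½; _+_; _*_; -_)
import Data.Rational.Properties as ℚP
open import Data.Product using (∃; _×_; _,_; proj₁; proj₂)
open import Data.Sum using (_⊎_; inj₁; inj₂)
import Data.Sum as Sum
open import Data.Empty using (⊥-elim)
open import Data.Fin.Permutation using (permutation)
open import Algebra.Bundles using (CommutativeRing)
open import Relation.Nullary using (¬_; yes; no; does)
open import Relation.Nullary.Decidable using (dec-true; dec-false; decidable-stable; _→-dec_)
open import Relation.Binary.PropositionalEquality
  using (_≡_; _≢_; refl; sym; trans; cong; cong₂; subst; module ≡-Reasoning)
open import Function using (_∘_)

open import Algebra.Properties.Semiring.Sum (CommutativeRing.semiring ℚP.+-*-commutativeRing)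
  using (sum; sum-syntax; sum-cong-≗; sum-replicate-zero; ∑-distrib-+; ∑-comm; sum-permute;
         *-distribˡ-sum; *-distribʳ-sum)
open import Algebra.Properties.Group ℚP.+-0-group using (⁻¹-involutive)

open ≡-Reasoning

Σℚ≡sum : ∀ n (f : Fin n → ℚ) → Σℚ n f ≡ sum f
Σℚ≡sum zero    f = refl
Σℚ≡sum (suc n) f = cong (f zero +_) (Σℚ≡sum n (f ∘ suc))

Σ-cong : ∀ n {f h : Fin n → ℚ} → (∀ i → f i ≡ h i) → Σℚ n f ≡ Σℚ n h
Σ-cong n {f} {h} f≗h = trans (Σℚ≡sum n f) (trans (sum-cong-≗ f≗h) (sym (Σℚ≡sum n h)))

Σ-zero : ∀ n (f : Fin n → ℚ) → (∀ i → f i ≡ 0ℚ) → Σℚ n f ≡ 0ℚ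
Σ-zero n f f≗0 = trans (Σ-cong n f≗0) (trans (Σℚ≡sum n _) (sum-replicate-zero n))

Σ-distrib-+ : ∀ n (f h : Fin n → ℚ) → Σℚ n (λ i → f i + h i) ≡ Σℚ n f + Σℚ n h
Σ-distrib-+ n f h = begin
  Σℚ n (λ i → f i + h i) ≡⟨ Σℚ≡sum n _ ⟩
  sum (λ i → f i + h i)  ≡⟨ ∑-distrib-+ f h ⟩
  sum f + sum h          ≡⟨ sym (cong₂ _+_ (Σℚ≡sum n f) (Σℚ≡sum n h)) ⟩
  Σℚ n f + Σℚ n h        ∎

Σ-*ˡ : ∀ n c (f : Fin n → ℚ) → c * Σℚ n f ≡ Σℚ n (λ i → c * f i)
Σ-*ˡ n c f = trans (cong (c *_) (Σℚ≡sum n f))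
                   (trans (*-distribˡ-sum c f) (sym (Σℚ≡sum n _)))

Σ-*ʳ : ∀ n c (f : Fin n → ℚ) → Σℚ n f * c ≡ Σℚ n (λ i → f i * c)
Σ-*ʳ n c f = trans (cong (_* c) (Σℚ≡sum n f))
                   (trans (*-distribʳ-sum c f) (sym (Σℚ≡sum n _)))

Σ-comm : ∀ n k (f : Fin n → Fin k → ℚ) →
         Σℚ n (λ i → Σℚ k (f i)) ≡ Σℚ k (λ j → Σℚ n (λ i → f i j))
Σ-comm n k f = begin
  Σℚ n (λ i → Σℚ k (f i))         ≡⟨ Σℚ≡sum n _ ⟩
  ∑[ i < n ] Σℚ k (f i)           ≡⟨ sum-cong-≗ (λ i → Σℚ≡sum k (f i)) ⟩
  ∑[ i < n ] ∑[ j < k ] f i j     ≡⟨ ∑-comm f ⟩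
  ∑[ j < k ] ∑[ i < n ] f i j     ≡⟨ sum-cong-≗ (λ j → sym (Σℚ≡sum n (λ i → f i j))) ⟩
  ∑[ j < k ] Σℚ n (λ i → f i j)   ≡⟨ sym (Σℚ≡sum k _) ⟩
  Σℚ k (λ j → Σℚ n (λ i → f i j)) ∎

Σ-involution : ∀ n (σ : Fin n → Fin n) → (∀ i → σ (σ i) ≡ i) →
               (f : Fin n → ℚ) → Σℚ n f ≡ Σℚ n (f ∘ σ)
Σ-involution n σ σσ f = trans (Σℚ≡sum n f)
  (trans (sum-permute f (permutation σ σ σσ σσ)) (sym (Σℚ≡sum n (f ∘ σ))))

Σ-select : ∀ n (i : Fin n) (f : Fin n → ℚ) → (∀ j → j ≢ i → f j ≡ 0ℚ) → Σℚ n f ≡ f i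
Σ-select (suc n) zero f off = begin
  f zero + Σℚ n (f ∘ suc) ≡⟨ cong (f zero +_) (Σ-zero n (f ∘ suc) (λ j → off (suc j) (λ ()))) ⟩
  f zero + 0ℚ             ≡⟨ ℚP.+-identityʳ (f zero) ⟩
  f zero                  ∎
Σ-select (suc n) (suc i) f off = begin
  f zero + Σℚ n (f ∘ suc) ≡⟨ cong₂ _+_ (off zero (λ ())) (Σ-select n i (f ∘ suc) offᵢ) ⟩
  0ℚ + f (suc i)          ≡⟨ ℚP.+-identityˡ (f (suc i)) ⟩
  f (suc i)               ∎
  where
  offᵢ : ∀ j → j ≢ i → f (suc j) ≡ 0ℚ
  offᵢ j j≢i = off (suc j) (j≢i ∘ suc-injective)

double-injective : ∀ {q r} → q + q ≡ r + r → q ≡ r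
double-injective {q} {r} 2q≡2r = trans (sym (halve q)) (trans (cong (½ *_) 2q≡2r) (halve r))
  where
  halve : ∀ p → ½ * (p + p) ≡ p
  halve p = begin
    ½ * (p + p)     ≡⟨ ℚP.*-distribˡ-+ ½ p p ⟩
    ½ * p + ½ * p   ≡⟨ sym (ℚP.*-distribʳ-+ p ½ ½) ⟩
    (½ + ½) * p     ≡⟨ ℚP.*-identityˡ p ⟩
    p               ∎

Σ-signReversing : ∀ n (σ : Fin n → Fin n) → (∀ i → σ (σ i) ≡ i) →
                  (z₀ : Fin n) → σ z₀ ≡ z₀ → (f : Fin n → ℚ) →
                  (∀ i → i ≢ z₀ → f (σ i) ≡ - f i) → Σℚ n f ≡ f z₀
Σ-signReversing n σ σσ z₀ σz₀ f reverses = double-injective (begin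
  Σℚ n f + Σℚ n f              ≡⟨ cong (Σℚ n f +_) (Σ-involution n σ σσ f) ⟩
  Σℚ n f + Σℚ n (f ∘ σ)        ≡⟨ sym (Σ-distrib-+ n f (f ∘ σ)) ⟩
  Σℚ n (λ i → f i + f (σ i))   ≡⟨ Σ-select n z₀ _ pairCancels ⟩
  f z₀ + f (σ z₀)              ≡⟨ cong (λ z → f z₀ + f z) σz₀ ⟩
  f z₀ + f z₀                  ∎)
  where
  pairCancels : ∀ i → i ≢ z₀ → f i + f (σ i) ≡ 0ℚ
  pairCancels i i≢z₀ = trans (cong (f i +_) (reverses i i≢z₀)) (ℚP.+-inverseʳ (f i))

δ-refl : ∀ {n} (i : Fin n) → δ i i ≡ 1ℚ
δ-refl zero    = refl
δ-refl (suc i) = δ-refl i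

δ-off : ∀ {n} (i j : Fin n) → i ≢ j → δ i j ≡ 0ℚ
δ-off zero    zero    i≢j = ⊥-elim (i≢j refl)
δ-off zero    (suc j) i≢j = refl
δ-off (suc i) zero    i≢j = refl
δ-off (suc i) (suc j) i≢j = δ-off i j (i≢j ∘ cong suc)

δ-·ˡ : ∀ n (i : Fin n) (f : Fin n → ℚ) → Σℚ n (λ w → δ i w * f w) ≡ f i
δ-·ˡ n i f = trans (Σ-select n i _ (λ w w≢i → trans (cong (_* f w) (δ-off i w (w≢i ∘ sym)))
                                                    (ℚP.*-zeroˡ (f w))))
                   (trans (cong (_* f i) (δ-refl i)) (ℚP.*-identityˡ (f i)))

δ-·ʳ : ∀ n (j : Fin n) (f : Fin n → ℚ) → Σℚ n (λ w → f w * δ w j) ≡ f j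
δ-·ʳ n j f = trans (Σ-select n j _ (λ w w≢j → trans (cong (f w *_) (δ-off w j w≢j))
                                                    (ℚP.*-zeroʳ (f w))))
                   (trans (cong (f j *_) (δ-refl j)) (ℚP.*-identityʳ (f j)))

rowOfInverse : ∀ {n} (L g : Matrix n) → (∀ i j → (L · g) i j ≡ δ i j) →
               (v : Fin n → ℚ) (x : Fin n) →
               (∀ w → Σℚ n (λ z → v z * L z w) ≡ δ x w) →
               ∀ y → g x y ≡ v y
rowOfInverse {n} L g Lg≡1 v x vL≡eₓ y = begin
  g x y                                           ≡⟨ sym (δ-·ˡ n x (λ w → g w y)) ⟩
  Σℚ n (λ w → δ x w * g w y)                      ≡⟨ Σ-cong n (λ w → cong (_* g w y) (sym (vL≡eₓ w))) ⟩
  Σℚ n (λ w → Σℚ n (λ z → v z * L z w) * g w y)   ≡⟨ Σ-cong n (λ w → Σ-*ʳ n (g w y) _) ⟩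
  Σℚ n (λ w → Σℚ n (λ z → v z * L z w * g w y))   ≡⟨ Σ-comm n n _ ⟩
  Σℚ n (λ z → Σℚ n (λ w → v z * L z w * g w y))   ≡⟨ Σ-cong n (λ z → Σ-cong n (λ w → ℚP.*-assoc (v z) (L z w) (g w y))) ⟩
  Σℚ n (λ z → Σℚ n (λ w → v z * (L z w * g w y))) ≡⟨ Σ-cong n (λ z → sym (Σ-*ˡ n (v z) _)) ⟩
  Σℚ n (λ z → v z * (L · g) z y)                  ≡⟨ Σ-cong n (λ z → cong (v z *_) (Lg≡1 z y)) ⟩
  Σℚ n (λ z → v z * δ z y)                        ≡⟨ δ-·ʳ n y v ⟩
  v y                                             ∎

toggle : ∀ {m} → Subset m → Fin m → Subset m
toggle (b ∷ s) zero    = not b ∷ s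
toggle (b ∷ s) (suc a) = b ∷ toggle s a

toggle-involutive : ∀ {m} (s : Subset m) a → toggle (toggle s a) a ≡ s
toggle-involutive (inside  ∷ s) zero    = refl
toggle-involutive (outside ∷ s) zero    = refl
toggle-involutive (b ∷ s)       (suc a) = cong (b ∷_) (toggle-involutive s a)

toggle-⊥ : ∀ {m} (a : Fin m) → toggle ⊥ a ≡ ⁅ a ⁆
toggle-⊥ zero    = refl
toggle-⊥ (suc a) = cong (outside ∷_) (toggle-⊥ a)

∈-toggle : ∀ {m} (s : Subset m) a {i} → i ∈ toggle s a → i ∈ s ⊎ i ≡ a
∈-toggle (b ∷ s) zero    {zero}  _         = inj₂ refl
∈-toggle (b ∷ s) zero    {suc i} (there p) = inj₁ (there p)
∈-toggle (b ∷ s) (suc a) {zero}  here      = inj₁ here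
∈-toggle (b ∷ s) (suc a) {suc i} (there p) = Sum.map there (cong suc) (∈-toggle s a p)

toggle-⊆ : ∀ {m} {s x : Subset m} {a} → a ∈ x → s ⊆ x → toggle s a ⊆ x
toggle-⊆ {s = s} {a = a} a∈x s⊆x p with ∈-toggle s a p
... | inj₁ i∈s  = s⊆x i∈s
... | inj₂ refl = a∈x

toggle-∩ : ∀ {m} (s t : Subset m) a → a ∉ t → toggle s a ∩ t ≡ s ∩ t
toggle-∩ (b       ∷ s) (inside  ∷ t) zero    a∉t = ⊥-elim (a∉t here)
toggle-∩ (inside  ∷ s) (outside ∷ t) zero    a∉t = refl
toggle-∩ (outside ∷ s) (outside ∷ t) zero    a∉t = refl
toggle-∩ (b       ∷ s) (c       ∷ t) (suc a) a∉t = cong (_ ∷_) (toggle-∩ s t a (a∉t ∘ there))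

toggle-empty : ∀ {m} (s : Subset m) a → ¬ Nonempty (toggle s a) → s ≡ ⁅ a ⁆
toggle-empty s a empty = begin
  s                        ≡⟨ sym (toggle-involutive s a) ⟩
  toggle (toggle s a) a    ≡⟨ cong (λ t → toggle t a) (Empty-unique empty) ⟩
  toggle ⊥ a               ≡⟨ toggle-⊥ a ⟩
  ⁅ a ⁆                    ∎

toggle-⁅⁆ : ∀ {m} (a : Fin m) → toggle ⁅ a ⁆ a ≡ ⊥
toggle-⁅⁆ a = trans (cong (λ t → toggle t a) (sym (toggle-⊥ a))) (toggle-involutive ⊥ a)

∣toggle∣ : ∀ {m} (s : Subset m) a →
           ∣ s ∣ ≡ suc ∣ toggle s a ∣ ⊎ ∣ toggle s a ∣ ≡ suc ∣ s ∣
∣toggle∣ (inside  ∷ s) zero    = inj₁ refl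
∣toggle∣ (outside ∷ s) zero    = inj₂ refl
∣toggle∣ (inside  ∷ s) (suc a) = Sum.map (cong suc) (cong suc) (∣toggle∣ s a)
∣toggle∣ (outside ∷ s) (suc a) = ∣toggle∣ s a

⁅⁆⊆ : ∀ {m} {a : Fin m} {s} → a ∈ s → ⁅ a ⁆ ⊆ s
⁅⁆⊆ {a = a} {s} a∈s i∈⁅a⁆ = subst (_∈ s) (sym (x∈⁅y⁆⇒x≡y a i∈⁅a⁆)) a∈s

nonempty⇒0<∣∣ : ∀ {m} {s : Subset m} → Nonempty s → 0 < ∣ s ∣
nonempty⇒0<∣∣ (a , a∈s) = subst (_≤ _) (∣⁅x⁆∣≡1 a) (p⊆q⇒∣p∣≤∣q∣ (⁅⁆⊆ a∈s))

⊈-witness : ∀ {m} (s t : Subset m) → ¬ s ⊆ t → ∃ λ a → a ∈ s × a ∉ t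
⊈-witness {m} s t s⊈t with ¬∀⟶∃¬ m (λ a → a ∈ s → a ∈ t) (λ a → a ∈? s →-dec a ∈? t) (λ h → s⊈t (h _))
... | a , a∈s↛a∈t = a , decidable-stable (a ∈? s) (λ a∉s → a∈s↛a∈t (⊥-elim ∘ a∉s))
                      , λ a∈t → a∈s↛a∈t (λ _ → a∈t)

ω-step : ∀ {m} {s t : Subset m} → ∣ t ∣ ≡ suc ∣ s ∣ → Nonempty s → ω t ≡ - ω s
ω-step {s = s} e ne with ∣ s ∣ | nonempty⇒0<∣∣ ne
... | suc k | _ = cong (λ c → signPow (c ∸ 1)) e

ω-toggle : ∀ {m} (s : Subset m) a → Nonempty s → Nonempty (toggle s a) →
           ω (toggle s a) ≡ - ω s
ω-toggle s a ne ne′ with ∣toggle∣ s a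
... | inj₁ e = trans (sym (⁻¹-involutive _)) (cong -_ (sym (ω-step {t = s} e ne′)))
... | inj₂ e = ω-step {t = toggle s a} e ne

ω-⁅⁆ : ∀ {m} (a : Fin m) → ω ⁅ a ⁆ ≡ 1ℚ
ω-⁅⁆ a = cong (λ c → signPow (c ∸ 1)) (∣⁅x⁆∣≡1 a)

meet : ∀ {m} → Subset m → Subset m → ℚ
meet s t = if does (nonempty? (s ∩ t)) then 1ℚ else 0ℚ

meet-1 : ∀ {m} {s t : Subset m} → Nonempty (s ∩ t) → meet s t ≡ 1ℚ
meet-1 {s = s} {t} p rewrite dec-true (nonempty? (s ∩ t)) p = refl

meet-0 : ∀ {m} {s t : Subset m} → ¬ Nonempty (s ∩ t) → meet s t ≡ 0ℚ
meet-0 {s = s} {t} p rewrite dec-false (nonempty? (s ∩ t)) p = refl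

meet-⊆ : ∀ {m} {s t : Subset m} → Nonempty s → s ⊆ t → meet s t ≡ 1ℚ
meet-⊆ (i , i∈s) s⊆t = meet-1 (i , x∈p∩q⁺ (i∈s , s⊆t i∈s))

meet-toggle : ∀ {m} (s t : Subset m) a → a ∉ t → meet (toggle s a) t ≡ meet s t
meet-toggle s t a a∉t = cong (λ u → if does (nonempty? u) then 1ℚ else 0ℚ) (toggle-∩ s t a a∉t)

meet-⁅⁆ : ∀ {m} (t : Subset m) a → a ∉ t → meet ⁅ a ⁆ t ≡ 0ℚ
meet-⁅⁆ t a a∉t = meet-0 λ (i , i∈⁅a⁆∩t) →
  let (i∈⁅a⁆ , i∈t) = x∈p∩q⁻ ⁅ a ⁆ t i∈⁅a⁆∩t
  in a∉t (subst (_∈ t) (x∈⁅y⁆⇒x≡y a i∈⁅a⁆) i∈t)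

module FacetRow {m n : ℕ} (G : Fin n → Subset m) (sc : IsSimplicialComplex G) (x : Fin n) where
  open IsSimplicialComplex sc

  ωₓ : Subset m → ℚ
  ωₓ s = if does (s ⊆? G x) then ω s else 0ℚ

  ωₓ-in : ∀ {s} → s ⊆ G x → ωₓ s ≡ ω s
  ωₓ-in {s} s⊆x rewrite dec-true (s ⊆? G x) s⊆x = refl

  ωₓ-out : ∀ {s} → ¬ s ⊆ G x → ωₓ s ≡ 0ℚ
  ωₓ-out {s} s⊈x rewrite dec-false (s ⊆? G x) s⊈x = refl

  v : Fin n → ℚ
  v z = ωₓ (G z)

  module Toggle (a : Fin m) (a∈x : a ∈ G x) where

    σ : Fin n → Fin n
    σ z with G z ⊆? G x | nonempty? (toggle (G z) a)
    ... | yes z⊆x | yes ne = proj₁ (downClosed x (toggle (G z) a) ne (toggle-⊆ a∈x z⊆x))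
    ... | yes _   | no _   = z
    ... | no _    | _      = z

    -- How σ acts on z: it either toggles a, or fixes a face outside x or {a}.
    -- (Indexed by the image σz so that 'with' can see σ z in the goal.)
    data Orbit (z σz : Fin n) : Set where
      paired    : G z ⊆ G x → Nonempty (toggle (G z) a) → G σz ≡ toggle (G z) a → Orbit z σz
      notFace   : ¬ G z ⊆ G x → σz ≡ z → Orbit z σz
      singleton : G z ≡ ⁅ a ⁆ → σz ≡ z → Orbit z σz

    orbit : ∀ z → Orbit z (σ z)
    orbit z with G z ⊆? G x | nonempty? (toggle (G z) a)
    ... | yes z⊆x | yes ne  = paired z⊆x ne (proj₂ (downClosed x (toggle (G z) a) ne (toggle-⊆ a∈x z⊆x)))
    ... | yes _   | no ¬ne  = singleton (toggle-empty (G z) a ¬ne) refl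
    ... | no z⊈x  | _       = notFace z⊈x refl

    σ-involutive : ∀ z → σ (σ z) ≡ z
    σ-involutive z with orbit z
    ... | notFace _ σz≡z   = trans (cong σ σz≡z) σz≡z
    ... | singleton _ σz≡z = trans (cong σ σz≡z) σz≡z
    ... | paired z⊆x _ e with orbit (σ z)
    ...   | paired _ _ e′ = distinct _ _ (begin
              G (σ (σ z))               ≡⟨ e′ ⟩
              toggle (G (σ z)) a        ≡⟨ cong (λ t → toggle t a) e ⟩
              toggle (toggle (G z) a) a ≡⟨ toggle-involutive (G z) a ⟩
              G z                       ∎)
    ...   | notFace σz⊈x _ = ⊥-elim (σz⊈x (subst (_⊆ G x) (sym e) (toggle-⊆ a∈x z⊆x)))
    ...   | singleton e′ _ = ⊥-elim (∉⊥ (proj₂ (subst Nonempty Gz≡⊥ (nonempty z))))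
      where
      Gz≡⊥ : G z ≡ ⊥
      Gz≡⊥ = begin
        G z                       ≡⟨ sym (toggle-involutive (G z) a) ⟩
        toggle (toggle (G z) a) a ≡⟨ cong (λ t → toggle t a) (trans (sym e) e′) ⟩
        toggle ⁅ a ⁆ a            ≡⟨ toggle-⁅⁆ a ⟩
        ⊥                         ∎

    vertex : ∃ λ j → G j ≡ ⁅ a ⁆
    vertex = downClosed x ⁅ a ⁆ (a , x∈⁅x⁆ a) (⁅⁆⊆ a∈x)

    σ-vertex : σ (proj₁ vertex) ≡ proj₁ vertex
    σ-vertex with orbit (proj₁ vertex)
    ... | paired _ ne _    = ⊥-elim (∉⊥ (proj₂ (subst Nonempty toggle≡⊥ ne)))
      where toggle≡⊥ = trans (cong (λ t → toggle t a) (proj₂ vertex)) (toggle-⁅⁆ a)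
    ... | notFace _ e      = e
    ... | singleton _ e    = e

    toggleSum : (t : Subset m) →
                (∀ s → s ⊆ G x → Nonempty s → Nonempty (toggle s a) → meet (toggle s a) t ≡ meet s t) →
                Σℚ n (λ z → v z * meet (G z) t) ≡ meet ⁅ a ⁆ t
    toggleSum t invariant = begin
      Σℚ n f                    ≡⟨ Σ-signReversing n σ σ-involutive j₀ σ-vertex f reverses ⟩
      ωₓ (G j₀) * meet (G j₀) t ≡⟨ cong (λ s → ωₓ s * meet s t) Gj₀≡⁅a⁆ ⟩
      ωₓ ⁅ a ⁆ * meet ⁅ a ⁆ t   ≡⟨ cong (_* meet ⁅ a ⁆ t) (trans (ωₓ-in (⁅⁆⊆ a∈x)) (ω-⁅⁆ a)) ⟩
      1ℚ * meet ⁅ a ⁆ t         ≡⟨ ℚP.*-identityˡ _ ⟩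
      meet ⁅ a ⁆ t              ∎
      where
      j₀ = proj₁ vertex
      Gj₀≡⁅a⁆ = proj₂ vertex
      fₛ : Subset m → ℚ
      fₛ s = ωₓ s * meet s t
      f : Fin n → ℚ
      f z = fₛ (G z)
      reverses : ∀ z → z ≢ j₀ → f (σ z) ≡ - f z
      reverses z z≢j₀ with orbit z
      ... | paired z⊆x ne e = begin
        fₛ (G (σ z))                              ≡⟨ cong fₛ e ⟩
        ωₓ (toggle (G z) a) * meet (toggle (G z) a) t
          ≡⟨ cong₂ _*_ (trans (ωₓ-in (toggle-⊆ a∈x z⊆x)) (ω-toggle (G z) a (nonempty z) ne))
                       (invariant (G z) z⊆x (nonempty z) ne) ⟩
        - ω (G z) * meet (G z) t                  ≡⟨ sym (ℚP.neg-distribˡ-* (ω (G z)) (meet (G z) t)) ⟩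
        - (ω (G z) * meet (G z) t)                ≡⟨ cong (λ c → - (c * meet (G z) t)) (sym (ωₓ-in z⊆x)) ⟩
        - f z                                     ∎
      ... | notFace z⊈x σz≡z = begin
        f (σ z)                  ≡⟨ cong f σz≡z ⟩
        f z                      ≡⟨ fz≡0 ⟩
        0ℚ                       ≡⟨ cong -_ (sym fz≡0) ⟩
        - f z                    ∎
        where
        fz≡0 : f z ≡ 0ℚ
        fz≡0 = trans (cong (_* meet (G z) t) (ωₓ-out z⊈x)) (ℚP.*-zeroˡ (meet (G z) t))
      ... | singleton Gz≡⁅a⁆ _ = ⊥-elim (z≢j₀ (distinct z j₀ (trans Gz≡⁅a⁆ (sym Gj₀≡⁅a⁆))))

  facetRow : IsFacet G x → ∀ w → Σℚ n (λ z → v z * connectionLaplacian G z w) ≡ δ x w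
  facetRow facet w with x ≟ w | nonempty x
  ... | yes refl | a , a∈x = begin
    Σℚ n (λ z → v z * meet (G z) (G x)) ≡⟨ toggleSum (G x) meetsX ⟩
    meet ⁅ a ⁆ (G x)                    ≡⟨ meet-⊆ (a , x∈⁅x⁆ a) (⁅⁆⊆ a∈x) ⟩
    1ℚ                                  ≡⟨ sym (δ-refl x) ⟩
    δ x x                               ∎
    where
    open Toggle a a∈x
    meetsX : ∀ s → s ⊆ G x → Nonempty s → Nonempty (toggle s a) →
             meet (toggle s a) (G x) ≡ meet s (G x)
    meetsX s s⊆x ne ne′ = trans (meet-⊆ ne′ (toggle-⊆ a∈x s⊆x)) (sym (meet-⊆ ne s⊆x))
  ... | no x≢w | _ with ⊈-witness (G x) (G w) (λ x⊆w → x≢w (distinct x w (sym (facet w x⊆w))))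
  ...   | a , a∈x , a∉w = begin
    Σℚ n (λ z → v z * meet (G z) (G w)) ≡⟨ toggleSum (G w) (λ s _ _ _ → meet-toggle s (G w) a a∉w) ⟩
    meet ⁅ a ⁆ (G w)                    ≡⟨ meet-⁅⁆ (G w) a a∉w ⟩
    0ℚ                                  ≡⟨ sym (δ-off x w x≢w) ⟩
    δ x w                               ∎
    where open Toggle a a∈x

mainTheorem2 : {m n : ℕ} (G : Fin n → Subset m) → IsSimplicialComplex G →
                 (g : Matrix n) → IsInverse (connectionLaplacian G) g →
                 (x y : Fin n) → IsFacet G x → G y ⊆ G x →
                 g x y ≡ ω (G y)
mainTheorem2 G sc g (Lg≡1 , _) x y facet y⊆x = begin
  g x y       ≡⟨ rowOfInverse (connectionLaplacian G) g Lg≡1 v x (facetRow facet) y ⟩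
  ωₓ (G y)    ≡⟨ ωₓ-in y⊆x ⟩
  ω (G y)     ∎
  where open FacetRow G sc x
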